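{- Let $t\ge 2$ and $j\ge 0$ be integers. The generating function for $t$-regular partitions with exactly $j$ parts is $$\sum_{i=0}^j \frac{q^{j-i}}{(q;q)_{j-i}}\,(-1)^i q^{\binom{i+1}{2}t}\,\frac{1}{(q^t;q^t)_i}.$$
   Context: A partition is $t$-regular if none of its parts is divisible by $t$. The generating function of a set of partitions is $\sum_\lambda q^{|\lambda|}$, $|\lambda|$ the sum of parts. Notation: $(a;q)_n=\prod_{i=0}^{n-1}(1-aq^i)$, with $(a;q)_0=1$. -}

module Defs where

open import Data.Nat as ℕ using (ℕ; zero; suc; _∸_; _≥_)
open import Data.Nat.Divisibility using (_∣_)
open import Data.Nat.Combinatorics using (_C_)
open import Data.Integer as ℤ using (ℤ; +_; -_; _+_; _*_; _-_)
open import Data.List using (List; []; _∷_; zipWith; upTo; applyUpTo; map; foldr; length)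
open import Data.List.Relation.Unary.All using (All)
open import Data.List.Relation.Unary.Linked using (Linked)
open import Relation.Nullary using (¬_)
open import Relation.Binary.PropositionalEquality using (_≡_)

sumℕ : List ℕ → ℕ
sumℕ = foldr ℕ._+_ 0

record IsPartitionOf (n : ℕ) (λs : List ℕ) : Set where
  field
    decreasing : Linked _≥_ λs
    positive   : All (λ p → p ≥ 1) λs
    total      : sumℕ λs ≡ n

TRegular : ℕ → List ℕ → Set
TRegular t λs = All (λ p → ¬ (t ∣ p)) λs

TRegPartition : (t j n : ℕ) → List ℕ → Set
TRegPartition t j n λs = IsPartitionOf n λs × (TRegular t λs × length λs ≡ j)
  where open import Data.Product using (_×_)

-- Formal power series in q with integer coefficients (coefficient maps)

Series : Set
Series = ℕ → ℤ

sumℤ : List ℤ → ℤ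
sumℤ = foldr _+_ (+ 0)

_⊛_ : Series → Series → Series
(f ⊛ g) n = sumℤ (map (λ k → f k * g (n ∸ k)) (upTo (suc n)))

_⊕_ : Series → Series → Series
(f ⊕ g) n = f n + g n

one : Series
one zero    = + 1
one (suc _) = + 0

mono : ℤ → ℕ → Series
mono c m n with m ℕ.≟ n
... | Relation.Nullary.yes _ = c
... | Relation.Nullary.no  _ = + 0

oneMinusQ^ : ℕ → Series
oneMinusQ^ m = one ⊕ mono (- + 1) m

prodS : List Series → Series
prodS = foldr _⊛_ one

-- (q^a ; q^b)_k = ∏_{m=0}^{k-1} (1 - q^{a + b m})
qPoch : (a b k : ℕ) → Series
qPoch a b k = prodS (applyUpTo (λ m → oneMinusQ^ (a ℕ.+ b ℕ.* m)) k)

-- Multiplicative inverse of a series with constant term 1: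
-- g 0 = 1,  g (n+1) = - Σ_{k=1}^{n+1} f k · g (n+1-k).
-- invRev f n = [g n, g (n-1), …, g 0]
invRev : Series → ℕ → List ℤ
invRev f zero    = + 1 ∷ []
invRev f (suc n) =
  (- sumℤ (zipWith _*_ (map (λ k → f (suc k)) (upTo (suc n))) (invRev f n)))
  ∷ invRev f n

headℤ : List ℤ → ℤ
headℤ []      = + 0
headℤ (x ∷ _) = x

-- 1 / f  (meaningful when f 0 = 1, as for all q-Pochhammer symbols used here)
inv : Series → Series
inv f n = headℤ (invRev f n)

sumSeries : (ℕ → Series) → ℕ → Series
sumSeries F j n = sumℤ (map (λ i → F i n) (upTo (suc j)))

sign : ℕ → ℤ
sign zero    = + 1
sign (suc i) = - sign i

rhs : (t j : ℕ) → Series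
rhs t j = sumSeries
  (λ i → ((mono (+ 1) (j ∸ i) ⊛ inv (qPoch 1 1 (j ∸ i)))
          ⊛ mono (sign i) ((suc i C 2) ℕ.* t))
          ⊛ inv (qPoch t t i))
  j

-- Put Y e j := Σ_{i ≤ j} q^{j-i}/(q;q)_{j-i} · (-1)^i q^{e i + binom(i,2) t}/(q^t;q^t)_i, so that the
-- right-hand side is Y t j. From q^m/(q;q)_m (1 - q^m) = q · q^{m-1}/(q;q)_{m-1} and the analogous
-- relation for the second factor, Y satisfies Y e 0 = 1,
--   Y (e+1) (j+1) = q Y (e+1) j + q^{j+1} Y e (j+1)   and   Y 1 (j+1) = q^{j+1} Y t (j+1).
-- These are also the recurrences of the generating function of the partitions into j parts none of
-- which is ≡ e (mod t), 1 ≤ e ≤ t: either the smallest part is 1 (allowed unless e = 1), or one can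
-- subtract 1 from every part, which turns the forbidden residue e into e - 1 (or t if e = 1). The
-- partitions are listed by a generator following this recursion, so its length obeys the same recurrences.
module Submission where

open import Defs
open import Data.Empty using (⊥-elim)
open import Data.Integer as ℤ using (ℤ; +_; -_; _+_; _*_)
import Data.Integer.Properties as ℤP
open import Algebra.Properties.AbelianGroup ℤP.+-0-abelianGroup using (∙-cancelʳ)
open import Data.Integer.Tactic.RingSolver using (solve-∀)
open import Data.List using (List; []; _∷_; _++_; map; upTo; applyUpTo; zipWith; length; reverse; foldl)
open import Data.List.Membership.Propositional using (_∈_)
open import Data.List.Membership.Propositional.Properties using (∈-map⁺; ∈-map⁻; ∈-++⁺ˡ; ∈-++⁺ʳ; ∈-++⁻)
import Data.List.Properties as LP
open import Data.List.Relation.Binary.Disjoint.Propositional using (Disjoint)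
open import Data.List.Relation.Binary.Permutation.Propositional using (↭-sym)
open import Data.List.Relation.Binary.Permutation.Propositional.Properties using (All-resp-↭; ↭-reverse)
open import Data.List.Relation.Unary.All as All using (All; []; _∷_)
import Data.List.Relation.Unary.All.Properties as AllP
open import Data.List.Relation.Unary.AllPairs using ([]; _∷_)
open import Data.List.Relation.Unary.Any using (here)
open import Data.List.Relation.Unary.Linked as Linked using (Linked; []; [-]; _∷_)
import Data.List.Relation.Unary.Linked.Properties as LinkedP
open import Data.List.Relation.Unary.Unique.Propositional using (Unique)
import Data.List.Relation.Unary.Unique.Propositional.Properties as UniqueP
open import Data.Nat as ℕ using (ℕ; zero; suc; _∸_; _≤_; _<_; _≥_; z≤n; s≤s; _≤?_)
open import Data.Nat.Combinatorics using (_C_; nC1≡n; nCk+nC[k+1]≡[n+1]C[k+1])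
open import Data.Nat.Divisibility using (_∣_; _∣?_; ∣-refl; ∣m∣n⇒∣m+n; ∣m+n∣m⇒∣n; ∣⇒≤)
open import Data.Nat.ListAction.Properties using (sum-↭)
import Data.Nat.Properties as ℕP
import Data.Nat.Tactic.RingSolver as NS
open import Data.Product using (Σ; ∃-syntax; _×_; _,_)
open import Data.Sum using (inj₁; inj₂; [_,_]′)
open import Function using (_∘_; id; flip)
open import Function.Bundles using (_⇔_; mk⇔)
open import Relation.Binary.PropositionalEquality
import Relation.Binary.Reasoning.Setoid
open import Relation.Nullary using (yes; no; ¬_)

-- Formal power series

∑ : ℕ → (ℕ → ℤ) → ℤ
∑ zero    h = + 0
∑ (suc m) h = h 0 + ∑ m (h ∘ suc)

sumℤ-map-applyUpTo : ∀ (h : ℕ → ℤ) g m → sumℤ (map h (applyUpTo g m)) ≡ ∑ m (h ∘ g)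
sumℤ-map-applyUpTo h g zero    = refl
sumℤ-map-applyUpTo h g (suc m) = cong (_+_ (h (g 0))) (sumℤ-map-applyUpTo h (g ∘ suc) m)

∑-cong : ∀ {h h′} m → (∀ k → k < m → h k ≡ h′ k) → ∑ m h ≡ ∑ m h′
∑-cong zero    eq = refl
∑-cong (suc m) eq = cong₂ _+_ (eq 0 (s≤s z≤n)) (∑-cong m (λ k k<m → eq (suc k) (s≤s k<m)))

∑-distrib-+ : ∀ (a b : ℕ → ℤ) m → ∑ m (λ k → a k + b k) ≡ ∑ m a + ∑ m b
∑-distrib-+ a b zero    = refl
∑-distrib-+ a b (suc m) = begin
  a 0 + b 0 + ∑ m (λ k → a (suc k) + b (suc k)) ≡⟨ cong (_+_ (a 0 + b 0)) (∑-distrib-+ (a ∘ suc) (b ∘ suc) m) ⟩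
  a 0 + b 0 + (∑ m (a ∘ suc) + ∑ m (b ∘ suc))   ≡⟨ interchange (a 0) (b 0) _ _ ⟩
  a 0 + ∑ m (a ∘ suc) + (b 0 + ∑ m (b ∘ suc))   ∎
  where
  open ≡-Reasoning
  interchange : ∀ w x y z → w + x + (y + z) ≡ w + y + (x + z)
  interchange = solve-∀

∑-*ˡ : ∀ c (a : ℕ → ℤ) m → ∑ m (λ k → c * a k) ≡ c * ∑ m a
∑-*ˡ c a zero    = sym (ℤP.*-zeroʳ c)
∑-*ˡ c a (suc m) = trans (cong (_+_ (c * a 0)) (∑-*ˡ c (a ∘ suc) m)) (sym (ℤP.*-distribˡ-+ c (a 0) _))

∑-suc : ∀ h m → ∑ (suc m) h ≡ ∑ m h + h m
∑-suc h zero    = trans (ℤP.+-identityʳ (h 0)) (sym (ℤP.+-identityˡ (h 0)))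
∑-suc h (suc m) = trans (cong (_+_ (h 0)) (∑-suc (h ∘ suc) m)) (sym (ℤP.+-assoc (h 0) _ _))

∑-reverse : ∀ h m → ∑ m h ≡ ∑ m (λ k → h (m ∸ suc k))
∑-reverse h zero    = refl
∑-reverse h (suc m) = begin
  h 0 + ∑ m (h ∘ suc)                        ≡⟨ cong (_+_ (h 0)) (∑-reverse (h ∘ suc) m) ⟩
  h 0 + ∑ m (λ k → h (suc (m ∸ suc k)))      ≡⟨ cong (_+_ (h 0)) (∑-cong m (λ k k<m → cong h (sym (ℕP.+-∸-assoc 1 k<m)))) ⟩
  h 0 + ∑ m (λ k → h (m ∸ k))                ≡⟨ ℤP.+-comm (h 0) _ ⟩
  ∑ m (λ k → h (m ∸ k)) + h 0                ≡⟨ cong (λ i → ∑ m (λ k → h (m ∸ k)) + h i) (sym (ℕP.n∸n≡0 m)) ⟩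
  ∑ m (λ k → h (m ∸ k)) + h (m ∸ m)          ≡⟨ ∑-suc (λ k → h (m ∸ k)) m ⟨
  ∑ (suc m) (λ k → h (suc m ∸ suc k))        ∎
  where open ≡-Reasoning

module ≗-Reasoning = Relation.Binary.Reasoning.Setoid (ℕ →-setoid ℤ)

infix 30 q^_
infixr 25 _·_

q^_ : ℕ → Series
q^ m = mono (+ 1) m

_·_ : ℤ → Series → Series
(c · f) n = c * f n

tail : Series → Series
tail f n = f (suc n)

⊕-cong : ∀ {f f′ g g′} → f ≗ f′ → g ≗ g′ → f ⊕ g ≗ f′ ⊕ g′
⊕-cong f≗f′ g≗g′ n = cong₂ _+_ (f≗f′ n) (g≗g′ n)

⊕-congˡ : ∀ {f f′} g → f ≗ f′ → f ⊕ g ≗ f′ ⊕ g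
⊕-congˡ g f≗f′ n = cong (_+ g n) (f≗f′ n)

⊕-congʳ : ∀ f {g g′} → g ≗ g′ → f ⊕ g ≗ f ⊕ g′
⊕-congʳ f g≗g′ n = cong (_+_ (f n)) (g≗g′ n)

⊕-assoc : ∀ f g h → (f ⊕ g) ⊕ h ≗ f ⊕ (g ⊕ h)
⊕-assoc f g h n = ℤP.+-assoc (f n) (g n) (h n)

·-congʳ : ∀ c {f g} → f ≗ g → c · f ≗ c · g
·-congʳ c f≗g n = cong (c *_) (f≗g n)

⊛-coeff : ∀ f g n → (f ⊛ g) n ≡ ∑ (suc n) (λ k → f k * g (n ∸ k))
⊛-coeff f g n = sumℤ-map-applyUpTo (λ k → f k * g (n ∸ k)) id (suc n)

⊛-coeff-zero : ∀ f g → (f ⊛ g) 0 ≡ f 0 * g 0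
⊛-coeff-zero f g = ℤP.+-identityʳ (f 0 * g 0)

⊛-coeff-suc : ∀ f g n → (f ⊛ g) (suc n) ≡ f 0 * g (suc n) + (tail f ⊛ g) n
⊛-coeff-suc f g n = trans (⊛-coeff f g (suc n)) (cong (_+_ (f 0 * g (suc n))) (sym (⊛-coeff (tail f) g n)))

⊛-cong : ∀ {f f′ g g′} → f ≗ f′ → g ≗ g′ → f ⊛ g ≗ f′ ⊛ g′
⊛-cong {f} {f′} {g} {g′} f≗f′ g≗g′ n = begin
  (f ⊛ g) n                             ≡⟨ ⊛-coeff f g n ⟩
  ∑ (suc n) (λ k → f k * g (n ∸ k))     ≡⟨ ∑-cong (suc n) (λ k _ → cong₂ _*_ (f≗f′ k) (g≗g′ (n ∸ k))) ⟩
  ∑ (suc n) (λ k → f′ k * g′ (n ∸ k))   ≡⟨ ⊛-coeff f′ g′ n ⟨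
  (f′ ⊛ g′) n                           ∎
  where open ≡-Reasoning

⊛-congˡ : ∀ {f f′} g → f ≗ f′ → f ⊛ g ≗ f′ ⊛ g
⊛-congˡ g f≗f′ = ⊛-cong f≗f′ (λ _ → refl)

⊛-congʳ : ∀ f {g g′} → g ≗ g′ → f ⊛ g ≗ f ⊛ g′
⊛-congʳ f = ⊛-cong {f} (λ _ → refl)

⊛-comm : ∀ f g → f ⊛ g ≗ g ⊛ f
⊛-comm f g n = begin
  (f ⊛ g) n                                     ≡⟨ ⊛-coeff f g n ⟩
  ∑ (suc n) (λ k → f k * g (n ∸ k))             ≡⟨ ∑-reverse (λ k → f k * g (n ∸ k)) (suc n) ⟩
  ∑ (suc n) (λ k → f (n ∸ k) * g (n ∸ (n ∸ k))) ≡⟨ ∑-cong (suc n) swap ⟩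
  ∑ (suc n) (λ k → g k * f (n ∸ k))             ≡⟨ ⊛-coeff g f n ⟨
  (g ⊛ f) n                                     ∎
  where
  open ≡-Reasoning
  swap : ∀ k → k < suc n → f (n ∸ k) * g (n ∸ (n ∸ k)) ≡ g k * f (n ∸ k)
  swap k (s≤s k≤n) = trans (cong (λ i → f (n ∸ k) * g i) (ℕP.m∸[m∸n]≡n k≤n)) (ℤP.*-comm (f (n ∸ k)) (g k))

⊛-distribˡ-⊕ : ∀ f g h → f ⊛ (g ⊕ h) ≗ (f ⊛ g) ⊕ (f ⊛ h)
⊛-distribˡ-⊕ f g h n = begin
  (f ⊛ (g ⊕ h)) n                                                         ≡⟨ ⊛-coeff f (g ⊕ h) n ⟩
  ∑ (suc n) (λ k → f k * (g (n ∸ k) + h (n ∸ k)))                         ≡⟨ ∑-cong (suc n) (λ k _ → ℤP.*-distribˡ-+ (f k) (g (n ∸ k)) (h (n ∸ k))) ⟩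
  ∑ (suc n) (λ k → f k * g (n ∸ k) + f k * h (n ∸ k))                     ≡⟨ ∑-distrib-+ (λ k → f k * g (n ∸ k)) (λ k → f k * h (n ∸ k)) (suc n) ⟩
  ∑ (suc n) (λ k → f k * g (n ∸ k)) + ∑ (suc n) (λ k → f k * h (n ∸ k))   ≡⟨ cong₂ _+_ (⊛-coeff f g n) (⊛-coeff f h n) ⟨
  ((f ⊛ g) ⊕ (f ⊛ h)) n                                                   ∎
  where open ≡-Reasoning

⊛-distribʳ-⊕ : ∀ f g h → (g ⊕ h) ⊛ f ≗ (g ⊛ f) ⊕ (h ⊛ f)
⊛-distribʳ-⊕ f g h n = trans (⊛-comm (g ⊕ h) f n)
  (trans (⊛-distribˡ-⊕ f g h n) (cong₂ _+_ (⊛-comm f g n) (⊛-comm f h n)))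

⊛-scaleˡ : ∀ c f g → (c · f) ⊛ g ≗ c · (f ⊛ g)
⊛-scaleˡ c f g n = begin
  ((c · f) ⊛ g) n                           ≡⟨ ⊛-coeff (c · f) g n ⟩
  ∑ (suc n) (λ k → c * f k * g (n ∸ k))     ≡⟨ ∑-cong (suc n) (λ k _ → ℤP.*-assoc c (f k) (g (n ∸ k))) ⟩
  ∑ (suc n) (λ k → c * (f k * g (n ∸ k)))   ≡⟨ ∑-*ˡ c (λ k → f k * g (n ∸ k)) (suc n) ⟩
  c * ∑ (suc n) (λ k → f k * g (n ∸ k))     ≡⟨ cong (c *_) (⊛-coeff f g n) ⟨
  (c · (f ⊛ g)) n                           ∎
  where open ≡-Reasoning

⊛-scaleʳ : ∀ c f g → f ⊛ (c · g) ≗ c · (f ⊛ g)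
⊛-scaleʳ c f g n = trans (⊛-comm f (c · g) n) (trans (⊛-scaleˡ c g f n) (cong (c *_) (⊛-comm g f n)))

⊛-zeroˡ : ∀ f g → (∀ n → f n ≡ + 0) → f ⊛ g ≗ (λ _ → + 0)
⊛-zeroˡ f g f≡0 n = trans (⊛-congˡ g (λ k → trans (f≡0 k) (sym (ℤP.*-zeroʳ (+ 0)))) n)
  (trans (⊛-scaleˡ (+ 0) (λ _ → + 0) g n) (ℤP.*-zeroˡ (((λ _ → + 0) ⊛ g) n)))

⊛-identityˡ : ∀ f → one ⊛ f ≗ f
⊛-identityˡ f zero    = trans (⊛-coeff-zero one f) (ℤP.*-identityˡ (f 0))
⊛-identityˡ f (suc n) = begin
  (one ⊛ f) (suc n)                   ≡⟨ ⊛-coeff-suc one f n ⟩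
  + 1 * f (suc n) + (tail one ⊛ f) n  ≡⟨ cong₂ _+_ (ℤP.*-identityˡ (f (suc n))) (⊛-zeroˡ (tail one) f (λ _ → refl) n) ⟩
  f (suc n) + + 0                     ≡⟨ ℤP.+-identityʳ (f (suc n)) ⟩
  f (suc n)                           ∎
  where open ≡-Reasoning

⊛-identityʳ : ∀ f → f ⊛ one ≗ f
⊛-identityʳ f n = trans (⊛-comm f one n) (⊛-identityˡ f n)

⊛-assoc : ∀ f g h → (f ⊛ g) ⊛ h ≗ f ⊛ (g ⊛ h)
⊛-assoc f g h zero = begin
  ((f ⊛ g) ⊛ h) 0    ≡⟨ trans (⊛-coeff-zero (f ⊛ g) h) (cong (_* h 0) (⊛-coeff-zero f g)) ⟩
  f 0 * g 0 * h 0    ≡⟨ ℤP.*-assoc (f 0) (g 0) (h 0) ⟩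
  f 0 * (g 0 * h 0)  ≡⟨ trans (⊛-coeff-zero f (g ⊛ h)) (cong (f 0 *_) (⊛-coeff-zero g h)) ⟨
  (f ⊛ (g ⊛ h)) 0    ∎
  where open ≡-Reasoning
⊛-assoc f g h (suc n) = begin
  ((f ⊛ g) ⊛ h) (suc n)
    ≡⟨ ⊛-coeff-suc (f ⊛ g) h n ⟩
  (f ⊛ g) 0 * h (suc n) + (tail (f ⊛ g) ⊛ h) n
    ≡⟨ cong₂ _+_ (cong (_* h (suc n)) (⊛-coeff-zero f g)) (⊛-congˡ h (⊛-coeff-suc f g) n) ⟩
  f 0 * g 0 * h (suc n) + (((f 0 · tail g) ⊕ (tail f ⊛ g)) ⊛ h) n
    ≡⟨ cong (_+_ (f 0 * g 0 * h (suc n))) (⊛-distribʳ-⊕ h (f 0 · tail g) (tail f ⊛ g) n) ⟩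
  f 0 * g 0 * h (suc n) + (((f 0 · tail g) ⊛ h) n + ((tail f ⊛ g) ⊛ h) n)
    ≡⟨ cong (_+_ (f 0 * g 0 * h (suc n))) (cong₂ _+_ (⊛-scaleˡ (f 0) (tail g) h n) (⊛-assoc (tail f) g h n)) ⟩
  f 0 * g 0 * h (suc n) + (f 0 * (tail g ⊛ h) n + (tail f ⊛ (g ⊛ h)) n)
    ≡⟨ regroup (f 0) (g 0) (h (suc n)) _ _ ⟩
  f 0 * (g 0 * h (suc n) + (tail g ⊛ h) n) + (tail f ⊛ (g ⊛ h)) n
    ≡⟨ cong (λ x → f 0 * x + (tail f ⊛ (g ⊛ h)) n) (⊛-coeff-suc g h n) ⟨
  f 0 * (g ⊛ h) (suc n) + (tail f ⊛ (g ⊛ h)) n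
    ≡⟨ ⊛-coeff-suc f (g ⊛ h) n ⟨
  (f ⊛ (g ⊛ h)) (suc n)
    ∎
  where
  open ≡-Reasoning
  regroup : ∀ a b c x y → a * b * c + (a * x + y) ≡ a * (b * c + x) + y
  regroup = solve-∀

⊛-interchange : ∀ f g h k → (f ⊛ g) ⊛ (h ⊛ k) ≗ (f ⊛ h) ⊛ (g ⊛ k)
⊛-interchange f g h k = begin
  (f ⊛ g) ⊛ (h ⊛ k)   ≈⟨ ⊛-assoc f g (h ⊛ k) ⟩
  f ⊛ (g ⊛ (h ⊛ k))   ≈⟨ ⊛-congʳ f (⊛-assoc g h k) ⟨
  f ⊛ ((g ⊛ h) ⊛ k)   ≈⟨ ⊛-congʳ f (⊛-congˡ k (⊛-comm g h)) ⟩
  f ⊛ ((h ⊛ g) ⊛ k)   ≈⟨ ⊛-congʳ f (⊛-assoc h g k) ⟩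
  f ⊛ (h ⊛ (g ⊛ k))   ≈⟨ ⊛-assoc f h (g ⊛ k) ⟨
  (f ⊛ h) ⊛ (g ⊛ k)   ∎
  where open ≗-Reasoning

⊛-leftComm : ∀ f g h → f ⊛ (g ⊛ h) ≗ g ⊛ (f ⊛ h)
⊛-leftComm f g h = begin
  f ⊛ (g ⊛ h)  ≈⟨ ⊛-assoc f g h ⟨
  (f ⊛ g) ⊛ h  ≈⟨ ⊛-congˡ h (⊛-comm f g) ⟩
  (g ⊛ f) ⊛ h  ≈⟨ ⊛-assoc g f h ⟩
  g ⊛ (f ⊛ h)  ∎
  where open ≗-Reasoning

q^-self : ∀ m → (q^ m) m ≡ + 1
q^-self m with m ℕ.≟ m
... | yes _  = refl
... | no m≢m = ⊥-elim (m≢m refl)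

q^-other : ∀ m n → m ≢ n → (q^ m) n ≡ + 0
q^-other m n m≢n with m ℕ.≟ n
... | yes m≡n = ⊥-elim (m≢n m≡n)
... | no _    = refl

q^0≗one : q^ 0 ≗ one
q^0≗one zero    = q^-self 0
q^0≗one (suc n) = q^-other 0 (suc n) (λ ())

tail-q^-suc : ∀ m → tail (q^ suc m) ≗ q^ m
tail-q^-suc m n with m ℕ.≟ n
... | yes refl = q^-self (suc m)
... | no m≢n   = q^-other (suc m) (suc n) (m≢n ∘ ℕP.suc-injective)

mono≗· : ∀ c m → mono c m ≗ c · q^ m
mono≗· c m n with m ℕ.≟ n
... | yes _ = sym (ℤP.*-identityʳ c)
... | no _  = sym (ℤP.*-zeroʳ c)

q^-⊛-≤ : ∀ {m n} f → m ≤ n → (q^ m ⊛ f) n ≡ f (n ∸ m)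
q^-⊛-≤ {zero}          f z≤n       = trans (⊛-congˡ f q^0≗one _) (⊛-identityˡ f _)
q^-⊛-≤ {suc m} {suc n} f (s≤s m≤n) = begin
  (q^ suc m ⊛ f) (suc n)                             ≡⟨ ⊛-coeff-suc (q^ suc m) f n ⟩
  (q^ suc m) 0 * f (suc n) + (tail (q^ suc m) ⊛ f) n ≡⟨ cong₂ _+_ (cong (_* f (suc n)) (q^-other (suc m) 0 (λ ()))) (⊛-congˡ f (tail-q^-suc m) n) ⟩
  + 0 * f (suc n) + (q^ m ⊛ f) n                      ≡⟨ ℤP.+-identityˡ _ ⟩
  (q^ m ⊛ f) n                                       ≡⟨ q^-⊛-≤ f m≤n ⟩
  f (n ∸ m)                                          ∎
  where open ≡-Reasoning

q^-⊛-< : ∀ {m n} f → n < m → (q^ m ⊛ f) n ≡ + 0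
q^-⊛-< {suc m} {zero}  f _         = trans (⊛-coeff-zero (q^ suc m) f)
  (trans (cong (_* f 0) (q^-other (suc m) 0 (λ ()))) (ℤP.*-zeroˡ (f 0)))
q^-⊛-< {suc m} {suc n} f (s≤s n<m) = begin
  (q^ suc m ⊛ f) (suc n)                             ≡⟨ ⊛-coeff-suc (q^ suc m) f n ⟩
  (q^ suc m) 0 * f (suc n) + (tail (q^ suc m) ⊛ f) n ≡⟨ cong₂ _+_ (cong (_* f (suc n)) (q^-other (suc m) 0 (λ ()))) (⊛-congˡ f (tail-q^-suc m) n) ⟩
  + 0 * f (suc n) + (q^ m ⊛ f) n                      ≡⟨ ℤP.+-identityˡ _ ⟩
  (q^ m ⊛ f) n                                       ≡⟨ q^-⊛-< f n<m ⟩
  + 0                                                ∎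
  where open ≡-Reasoning

q^-+-∸ : ∀ {m n} k → m ≤ n → (q^ (m ℕ.+ k)) n ≡ (q^ k) (n ∸ m)
q^-+-∸ k z≤n       = refl
q^-+-∸ k (s≤s m≤n) = trans (tail-q^-suc _ _) (q^-+-∸ k m≤n)

q^-⊛-q^ : ∀ m k → q^ m ⊛ q^ k ≗ q^ (m ℕ.+ k)
q^-⊛-q^ m k n with m ≤? n
... | yes m≤n = trans (q^-⊛-≤ (q^ k) m≤n) (sym (q^-+-∸ k m≤n))
... | no m≰n  = trans (q^-⊛-< (q^ k) (ℕP.≰⇒> m≰n))
  (sym (q^-other (m ℕ.+ k) n (λ m+k≡n → m≰n (subst (m ≤_) m+k≡n (ℕP.m≤m+n m k)))))

zipWith-*-map : ∀ (a b : ℕ → ℤ) xs → zipWith _*_ (map a xs) (map b xs) ≡ map (λ k → a k * b k) xs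
zipWith-*-map a b []       = refl
zipWith-*-map a b (x ∷ xs) = cong (a x * b x ∷_) (zipWith-*-map a b xs)

invRev≡map : ∀ f n → invRev f n ≡ map (λ k → inv f (n ∸ k)) (upTo (suc n))
invRev≡map f zero    = refl
invRev≡map f (suc n) = cong (inv f (suc n) ∷_) (begin
  invRev f n                                            ≡⟨ invRev≡map f n ⟩
  map (λ k → inv f (n ∸ k)) (upTo (suc n))              ≡⟨ LP.map-upTo (λ k → inv f (n ∸ k)) (suc n) ⟩
  applyUpTo (λ k → inv f (n ∸ k)) (suc n)               ≡⟨ LP.map-applyUpTo suc (λ k → inv f (suc n ∸ k)) (suc n) ⟨
  map (λ k → inv f (suc n ∸ k)) (applyUpTo suc (suc n)) ∎)
  where open ≡-Reasoning

inv-suc : ∀ f n → inv f (suc n) ≡ - ∑ (suc n) (λ k → f (suc k) * inv f (n ∸ k))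
inv-suc f n = cong -_ (begin
  sumℤ (zipWith _*_ (map (f ∘ suc) (upTo (suc n))) (invRev f n))
    ≡⟨ cong (λ xs → sumℤ (zipWith _*_ (map (f ∘ suc) (upTo (suc n))) xs)) (invRev≡map f n) ⟩
  sumℤ (zipWith _*_ (map (f ∘ suc) (upTo (suc n))) (map (λ k → inv f (n ∸ k)) (upTo (suc n))))
    ≡⟨ cong sumℤ (zipWith-*-map (f ∘ suc) (λ k → inv f (n ∸ k)) (upTo (suc n))) ⟩
  sumℤ (map (λ k → f (suc k) * inv f (n ∸ k)) (upTo (suc n)))
    ≡⟨ sumℤ-map-applyUpTo (λ k → f (suc k) * inv f (n ∸ k)) id (suc n) ⟩
  ∑ (suc n) (λ k → f (suc k) * inv f (n ∸ k))
    ∎)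
  where open ≡-Reasoning

⊛-inverseʳ : ∀ f → f 0 ≡ + 1 → f ⊛ inv f ≗ one
⊛-inverseʳ f f0≡1 zero    = trans (⊛-coeff-zero f (inv f)) (cong (_* + 1) f0≡1)
⊛-inverseʳ f f0≡1 (suc n) = begin
  (f ⊛ inv f) (suc n)                      ≡⟨ ⊛-coeff-suc f (inv f) n ⟩
  f 0 * inv f (suc n) + (tail f ⊛ inv f) n ≡⟨ cong₂ _+_ (cong₂ _*_ f0≡1 (inv-suc f n)) (⊛-coeff (tail f) (inv f) n) ⟩
  + 1 * - s + s                            ≡⟨ cancel s ⟩
  + 0                                      ∎
  where
  open ≡-Reasoning
  s = ∑ (suc n) (λ k → f (suc k) * inv f (n ∸ k))
  cancel : ∀ x → + 1 * - x + x ≡ + 0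
  cancel = solve-∀

inv-unique : ∀ f g → f 0 ≡ + 1 → g ⊛ f ≗ one → g ≗ inv f
inv-unique f g f0≡1 g⊛f≗1 = begin
  g                ≈⟨ ⊛-identityʳ g ⟨
  g ⊛ one          ≈⟨ ⊛-congʳ g (⊛-inverseʳ f f0≡1) ⟨
  g ⊛ (f ⊛ inv f)  ≈⟨ ⊛-assoc g f (inv f) ⟨
  (g ⊛ f) ⊛ inv f  ≈⟨ ⊛-congˡ (inv f) g⊛f≗1 ⟩
  one ⊛ inv f      ≈⟨ ⊛-identityˡ (inv f) ⟩
  inv f            ∎
  where open ≗-Reasoning

inv-one : inv one ≗ one
inv-one n = sym (inv-unique one one refl (⊛-identityˡ one) n)

prodS-applyUpTo-suc : ∀ (h : ℕ → Series) k → prodS (applyUpTo h (suc k)) ≗ prodS (applyUpTo h k) ⊛ h k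
prodS-applyUpTo-suc h zero    = ⊛-comm (h 0) one
prodS-applyUpTo-suc h (suc k) = begin
  h 0 ⊛ prodS (applyUpTo (h ∘ suc) (suc k))         ≈⟨ ⊛-congʳ (h 0) (prodS-applyUpTo-suc (h ∘ suc) k) ⟩
  h 0 ⊛ (prodS (applyUpTo (h ∘ suc) k) ⊛ h (suc k)) ≈⟨ ⊛-assoc (h 0) _ (h (suc k)) ⟨
  (h 0 ⊛ prodS (applyUpTo (h ∘ suc) k)) ⊛ h (suc k) ∎
  where open ≗-Reasoning

prodS-applyUpTo-constant : ∀ (h : ℕ → Series) k → (∀ m → h m 0 ≡ + 1) → prodS (applyUpTo h k) 0 ≡ + 1
prodS-applyUpTo-constant h zero    h0≡1 = refl
prodS-applyUpTo-constant h (suc k) h0≡1 = trans (⊛-coeff-zero (h 0) (prodS (applyUpTo (h ∘ suc) k)))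
  (cong₂ _*_ (h0≡1 0) (prodS-applyUpTo-constant (h ∘ suc) k (h0≡1 ∘ suc)))

qPoch-constant : ∀ {a} b k → 1 ≤ a → qPoch a b k 0 ≡ + 1
qPoch-constant {a} b k 1≤a =
  prodS-applyUpTo-constant _ k (λ m → oneMinusQ^-constant (ℕP.≤-trans 1≤a (ℕP.m≤m+n a (b ℕ.* m))))
  where
  oneMinusQ^-constant : ∀ {m} → 1 ≤ m → oneMinusQ^ m 0 ≡ + 1
  oneMinusQ^-constant {suc m} _ = refl

inv-qPoch-suc : ∀ {a} b k → 1 ≤ a → inv (qPoch a b (suc k)) ⊛ oneMinusQ^ (a ℕ.+ b ℕ.* k) ≗ inv (qPoch a b k)
inv-qPoch-suc {a} b k 1≤a = inv-unique P (inv P′ ⊛ u) (qPoch-constant b k 1≤a) (begin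
  (inv P′ ⊛ u) ⊛ P   ≈⟨ ⊛-assoc (inv P′) u P ⟩
  inv P′ ⊛ (u ⊛ P)   ≈⟨ ⊛-congʳ (inv P′) (⊛-comm u P) ⟩
  inv P′ ⊛ (P ⊛ u)   ≈⟨ ⊛-congʳ (inv P′) (prodS-applyUpTo-suc _ k) ⟨
  inv P′ ⊛ P′        ≈⟨ ⊛-comm (inv P′) P′ ⟩
  P′ ⊛ inv P′        ≈⟨ ⊛-inverseʳ P′ (qPoch-constant b (suc k) 1≤a) ⟩
  one                ∎)
  where
  open ≗-Reasoning
  P P′ u : Series
  P  = qPoch a b k
  P′ = qPoch a b (suc k)
  u  = oneMinusQ^ (a ℕ.+ b ℕ.* k)

⊛-oneMinusQ^ : ∀ f m → (f ⊛ oneMinusQ^ m) ⊕ (q^ m ⊛ f) ≗ f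
⊛-oneMinusQ^ f m n = begin
  (f ⊛ (one ⊕ mono (- + 1) m)) n + x         ≡⟨ cong (_+ x) (⊛-distribˡ-⊕ f one (mono (- + 1) m) n) ⟩
  (f ⊛ one) n + (f ⊛ mono (- + 1) m) n + x   ≡⟨ cong (_+ x) (cong₂ _+_ (⊛-identityʳ f n) (⊛-comm f (mono (- + 1) m) n)) ⟩
  f n + (mono (- + 1) m ⊛ f) n + x           ≡⟨ cong (λ y → f n + y + x) (⊛-congˡ f (mono≗· (- + 1) m) n) ⟩
  f n + (((- + 1) · q^ m) ⊛ f) n + x         ≡⟨ cong (λ y → f n + y + x) (⊛-scaleˡ (- + 1) (q^ m) f n) ⟩
  f n + - + 1 * x + x                        ≡⟨ cancel (f n) x ⟩
  f n                                        ∎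
  where
  open ≡-Reasoning
  x = (q^ m ⊛ f) n
  cancel : ∀ y x → y + - + 1 * x + x ≡ y
  cancel = solve-∀

-- Convolution of sequences of series

∑ₛ : ℕ → (ℕ → Series) → Series
∑ₛ m F n = ∑ m (λ i → F i n)

∑ₛ-cong : ∀ {F G} m → (∀ i → i < m → F i ≗ G i) → ∑ₛ m F ≗ ∑ₛ m G
∑ₛ-cong m F≗G n = ∑-cong m (λ i i<m → F≗G i i<m n)

∑ₛ-suc : ∀ F m → ∑ₛ (suc m) F ≗ ∑ₛ m F ⊕ F m
∑ₛ-suc F m n = ∑-suc (λ i → F i n) m

∑ₛ-distrib-⊕ : ∀ F G m → ∑ₛ m (λ i → F i ⊕ G i) ≗ ∑ₛ m F ⊕ ∑ₛ m G
∑ₛ-distrib-⊕ F G m n = ∑-distrib-+ (λ i → F i n) (λ i → G i n) m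

⊛-∑ₛ : ∀ f F m → f ⊛ ∑ₛ m F ≗ ∑ₛ m (λ i → f ⊛ F i)
⊛-∑ₛ f F zero    n = trans (⊛-comm f (∑ₛ 0 F) n) (⊛-zeroˡ (∑ₛ 0 F) f (λ _ → refl) n)
⊛-∑ₛ f F (suc m) n = trans (⊛-distribˡ-⊕ f (F 0) (∑ₛ m (F ∘ suc)) n)
  (cong (_+_ ((f ⊛ F 0) n)) (⊛-∑ₛ f (F ∘ suc) m n))

infixl 20 _⋆_

_⋆_ : (ℕ → Series) → (ℕ → Series) → ℕ → Series
(a ⋆ b) j = ∑ₛ (suc j) (λ i → a (j ∸ i) ⊛ b i)

⋆-zero : ∀ a b → (a ⋆ b) 0 ≗ a 0 ⊛ b 0
⋆-zero a b n = ℤP.+-identityʳ ((a 0 ⊛ b 0) n)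

⋆-suc-back : ∀ a b j → (a ⋆ b) (suc j) ≗ ((a ∘ suc) ⋆ b) j ⊕ (a 0 ⊛ b (suc j))
⋆-suc-back a b j = begin
  ∑ₛ (suc (suc j)) (λ i → a (suc j ∸ i) ⊛ b i)                           ≈⟨ ∑ₛ-suc (λ i → a (suc j ∸ i) ⊛ b i) (suc j) ⟩
  ∑ₛ (suc j) (λ i → a (suc j ∸ i) ⊛ b i) ⊕ (a (suc j ∸ suc j) ⊛ b (suc j)) ≈⟨ ⊕-cong (∑ₛ-cong (suc j) front) last ⟩
  ∑ₛ (suc j) (λ i → a (suc (j ∸ i)) ⊛ b i) ⊕ (a 0 ⊛ b (suc j))            ∎
  where
  open ≗-Reasoning
  front : ∀ i → i < suc j → a (suc j ∸ i) ⊛ b i ≗ a (suc (j ∸ i)) ⊛ b i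
  front i (s≤s i≤j) = ⊛-congˡ (b i) (λ n → cong (λ m → a m n) (ℕP.+-∸-assoc 1 i≤j))
  last : a (suc j ∸ suc j) ⊛ b (suc j) ≗ a 0 ⊛ b (suc j)
  last n = cong (λ m → (a m ⊛ b (suc j)) n) (ℕP.n∸n≡0 j)

⋆-congˡ : ∀ {a a′} b j → (∀ m → a m ≗ a′ m) → (a ⋆ b) j ≗ (a′ ⋆ b) j
⋆-congˡ b j a≗a′ = ∑ₛ-cong (suc j) (λ i _ → ⊛-congˡ (b i) (a≗a′ (j ∸ i)))

⋆-congʳ : ∀ a {b b′} j → (∀ i → b i ≗ b′ i) → (a ⋆ b) j ≗ (a ⋆ b′) j
⋆-congʳ a j b≗b′ = ∑ₛ-cong (suc j) (λ i _ → ⊛-congʳ (a (j ∸ i)) (b≗b′ i))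

⋆-distribˡ-⊕ : ∀ a a′ b j → ((λ m → a m ⊕ a′ m) ⋆ b) j ≗ (a ⋆ b) j ⊕ (a′ ⋆ b) j
⋆-distribˡ-⊕ a a′ b j = begin
  ∑ₛ (suc j) (λ i → (a (j ∸ i) ⊕ a′ (j ∸ i)) ⊛ b i)           ≈⟨ ∑ₛ-cong (suc j) (λ i _ → ⊛-distribʳ-⊕ (b i) (a (j ∸ i)) (a′ (j ∸ i))) ⟩
  ∑ₛ (suc j) (λ i → (a (j ∸ i) ⊛ b i) ⊕ (a′ (j ∸ i) ⊛ b i))   ≈⟨ ∑ₛ-distrib-⊕ (λ i → a (j ∸ i) ⊛ b i) (λ i → a′ (j ∸ i) ⊛ b i) (suc j) ⟩
  (a ⋆ b) j ⊕ (a′ ⋆ b) j                                     ∎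
  where open ≗-Reasoning

⋆-distribʳ-⊕ : ∀ a b b′ j → (a ⋆ (λ i → b i ⊕ b′ i)) j ≗ (a ⋆ b) j ⊕ (a ⋆ b′) j
⋆-distribʳ-⊕ a b b′ j = begin
  ∑ₛ (suc j) (λ i → a (j ∸ i) ⊛ (b i ⊕ b′ i))                 ≈⟨ ∑ₛ-cong (suc j) (λ i _ → ⊛-distribˡ-⊕ (a (j ∸ i)) (b i) (b′ i)) ⟩
  ∑ₛ (suc j) (λ i → (a (j ∸ i) ⊛ b i) ⊕ (a (j ∸ i) ⊛ b′ i))   ≈⟨ ∑ₛ-distrib-⊕ (λ i → a (j ∸ i) ⊛ b i) (λ i → a (j ∸ i) ⊛ b′ i) (suc j) ⟩
  (a ⋆ b) j ⊕ (a ⋆ b′) j                                     ∎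
  where open ≗-Reasoning

⋆-⊛ˡ : ∀ f a b j → ((λ m → f ⊛ a m) ⋆ b) j ≗ f ⊛ (a ⋆ b) j
⋆-⊛ˡ f a b j = begin
  ∑ₛ (suc j) (λ i → (f ⊛ a (j ∸ i)) ⊛ b i)   ≈⟨ ∑ₛ-cong (suc j) (λ i _ → ⊛-assoc f (a (j ∸ i)) (b i)) ⟩
  ∑ₛ (suc j) (λ i → f ⊛ (a (j ∸ i) ⊛ b i))   ≈⟨ ⊛-∑ₛ f (λ i → a (j ∸ i) ⊛ b i) (suc j) ⟨
  f ⊛ (a ⋆ b) j                              ∎
  where open ≗-Reasoning

⋆-⊛ʳ : ∀ f a b j → (a ⋆ (λ i → f ⊛ b i)) j ≗ f ⊛ (a ⋆ b) j
⋆-⊛ʳ f a b j = begin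
  ∑ₛ (suc j) (λ i → a (j ∸ i) ⊛ (f ⊛ b i))   ≈⟨ ∑ₛ-cong (suc j) (λ i _ → ⊛-leftComm (a (j ∸ i)) f (b i)) ⟩
  ∑ₛ (suc j) (λ i → f ⊛ (a (j ∸ i) ⊛ b i))   ≈⟨ ⊛-∑ₛ f (λ i → a (j ∸ i) ⊛ b i) (suc j) ⟨
  f ⊛ (a ⋆ b) j                              ∎
  where open ≗-Reasoning

⋆-q^ : ∀ a b j → ((λ m → q^ m ⊛ a m) ⋆ (λ i → q^ i ⊛ b i)) j ≗ q^ j ⊛ (a ⋆ b) j
⋆-q^ a b j = begin
  ∑ₛ (suc j) (λ i → (q^ (j ∸ i) ⊛ a (j ∸ i)) ⊛ (q^ i ⊛ b i))   ≈⟨ ∑ₛ-cong (suc j) collect ⟩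
  ∑ₛ (suc j) (λ i → q^ j ⊛ (a (j ∸ i) ⊛ b i))                 ≈⟨ ⊛-∑ₛ (q^ j) (λ i → a (j ∸ i) ⊛ b i) (suc j) ⟨
  q^ j ⊛ (a ⋆ b) j                                            ∎
  where
  open ≗-Reasoning
  collect : ∀ i → i < suc j → (q^ (j ∸ i) ⊛ a (j ∸ i)) ⊛ (q^ i ⊛ b i) ≗ q^ j ⊛ (a (j ∸ i) ⊛ b i)
  collect i (s≤s i≤j) = begin
    (q^ (j ∸ i) ⊛ a (j ∸ i)) ⊛ (q^ i ⊛ b i)   ≈⟨ ⊛-interchange (q^ (j ∸ i)) (a (j ∸ i)) (q^ i) (b i) ⟩
    (q^ (j ∸ i) ⊛ q^ i) ⊛ (a (j ∸ i) ⊛ b i)   ≈⟨ ⊛-congˡ (a (j ∸ i) ⊛ b i) (q^-⊛-q^ (j ∸ i) i) ⟩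
    q^ (j ∸ i ℕ.+ i) ⊛ (a (j ∸ i) ⊛ b i)      ≡⟨ cong (λ m → q^ m ⊛ (a (j ∸ i) ⊛ b i)) (ℕP.m∸n+n≡m i≤j) ⟩
    q^ j ⊛ (a (j ∸ i) ⊛ b i)                  ∎

sign-suc : ∀ i f → sign (suc i) · f ≗ (- + 1) · (sign i · f)
sign-suc i f n = negate (sign i) (f n)
  where
  negate : ∀ s x → - s * x ≡ - + 1 * (s * x)
  negate = solve-∀

suc-C-2 : ∀ i → suc i C 2 ≡ i ℕ.+ i C 2
suc-C-2 i = trans (sym (nCk+nC[k+1]≡[n+1]C[k+1] i 1)) (cong (ℕ._+ i C 2) (nC1≡n i))

module FormalSums {t : ℕ} (1≤t : 1 ≤ t) where

  A : ℕ → Series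
  A m = q^ m ⊛ inv (qPoch 1 1 m)

  exponent : ℕ → ℕ → ℕ
  exponent e i = e ℕ.* i ℕ.+ (i C 2) ℕ.* t

  B : ℕ → ℕ → Series
  B e i = sign i · (q^ exponent e i ⊛ inv (qPoch t t i))

  Y : ℕ → ℕ → Series
  Y e = A ⋆ B e

  A-zero : A 0 ≗ one
  A-zero = begin
    q^ 0 ⊛ inv one  ≈⟨ ⊛-cong q^0≗one inv-one ⟩
    one ⊛ one       ≈⟨ ⊛-identityˡ one ⟩
    one             ∎
    where open ≗-Reasoning

  A-⊛-oneMinusQ^ : ∀ m → A (suc m) ⊛ oneMinusQ^ (suc m) ≗ q^ 1 ⊛ A m
  A-⊛-oneMinusQ^ m = begin
    (q^ suc m ⊛ inv P′) ⊛ oneMinusQ^ (suc m)   ≈⟨ ⊛-assoc (q^ suc m) (inv P′) (oneMinusQ^ (suc m)) ⟩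
    q^ suc m ⊛ (inv P′ ⊛ oneMinusQ^ (suc m))   ≈⟨ ⊛-congʳ (q^ suc m) peel ⟩
    q^ suc m ⊛ inv P                           ≈⟨ ⊛-congˡ (inv P) (q^-⊛-q^ 1 m) ⟨
    (q^ 1 ⊛ q^ m) ⊛ inv P                      ≈⟨ ⊛-assoc (q^ 1) (q^ m) (inv P) ⟩
    q^ 1 ⊛ A m                                 ∎
    where
    open ≗-Reasoning
    P P′ : Series
    P  = qPoch 1 1 m
    P′ = qPoch 1 1 (suc m)
    peel : inv P′ ⊛ oneMinusQ^ (suc m) ≗ inv P
    peel = subst (λ x → inv P′ ⊛ oneMinusQ^ x ≗ inv P) (cong suc (ℕP.+-identityʳ m)) (inv-qPoch-suc 1 m ℕP.≤-refl)

  A-suc : ∀ m → A (suc m) ≗ (q^ 1 ⊛ A m) ⊕ (q^ suc m ⊛ A (suc m))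
  A-suc m = begin
    A (suc m)                                                  ≈⟨ ⊛-oneMinusQ^ (A (suc m)) (suc m) ⟨
    (A (suc m) ⊛ oneMinusQ^ (suc m)) ⊕ (q^ suc m ⊛ A (suc m))  ≈⟨ ⊕-congˡ (q^ suc m ⊛ A (suc m)) (A-⊛-oneMinusQ^ m) ⟩
    (q^ 1 ⊛ A m) ⊕ (q^ suc m ⊛ A (suc m))                      ∎
    where open ≗-Reasoning

  B-zero : ∀ e → B e 0 ≗ one
  B-zero e n = begin
    + 1 * (q^ (e ℕ.* 0 ℕ.+ 0) ⊛ inv one) n  ≡⟨ ℤP.*-identityˡ _ ⟩
    (q^ (e ℕ.* 0 ℕ.+ 0) ⊛ inv one) n        ≡⟨ cong (λ m → (q^ m ⊛ inv one) n) (trans (ℕP.+-identityʳ (e ℕ.* 0)) (ℕP.*-zeroʳ e)) ⟩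
    (q^ 0 ⊛ inv one) n                      ≡⟨ A-zero n ⟩
    one n                                   ∎
    where open ≡-Reasoning

  B-shift : ∀ k e i → B (k ℕ.+ e) i ≗ q^ (k ℕ.* i) ⊛ B e i
  B-shift k e i = begin
    sign i · (q^ exponent (k ℕ.+ e) i ⊛ inv P)           ≡⟨ cong (λ x → sign i · (q^ x ⊛ inv P)) (split k e i ((i C 2) ℕ.* t)) ⟩
    sign i · (q^ (k ℕ.* i ℕ.+ exponent e i) ⊛ inv P)     ≈⟨ ·-congʳ (sign i) (⊛-congˡ (inv P) (q^-⊛-q^ (k ℕ.* i) (exponent e i))) ⟨
    sign i · ((q^ (k ℕ.* i) ⊛ q^ exponent e i) ⊛ inv P)  ≈⟨ ·-congʳ (sign i) (⊛-assoc (q^ (k ℕ.* i)) (q^ exponent e i) (inv P)) ⟩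
    sign i · (q^ (k ℕ.* i) ⊛ (q^ exponent e i ⊛ inv P))  ≈⟨ ⊛-scaleʳ (sign i) (q^ (k ℕ.* i)) (q^ exponent e i ⊛ inv P) ⟨
    q^ (k ℕ.* i) ⊛ B e i                                 ∎
    where
    open ≗-Reasoning
    P = qPoch t t i
    split : ∀ k e i c → (k ℕ.+ e) ℕ.* i ℕ.+ c ≡ k ℕ.* i ℕ.+ (e ℕ.* i ℕ.+ c)
    split = NS.solve-∀

  exponent-suc : ∀ e i → exponent e (suc i) ≡ (e ℕ.+ t ℕ.* i) ℕ.+ exponent e i
  exponent-suc e i = trans (cong (λ c → e ℕ.* suc i ℕ.+ c ℕ.* t) (suc-C-2 i)) (regroup e i (i C 2) t)
    where
    regroup : ∀ e i c t → e ℕ.* suc i ℕ.+ (i ℕ.+ c) ℕ.* t ≡ (e ℕ.+ t ℕ.* i) ℕ.+ (e ℕ.* i ℕ.+ c ℕ.* t)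
    regroup = NS.solve-∀

  B-⊛-oneMinusQ^ : ∀ e i → B e (suc i) ⊛ oneMinusQ^ (t ℕ.+ t ℕ.* i) ≗ (- + 1) · (q^ (e ℕ.+ t ℕ.* i) ⊛ B e i)
  B-⊛-oneMinusQ^ e i = begin
    (s′ · (q^ exponent e (suc i) ⊛ inv P′)) ⊛ u              ≈⟨ ⊛-scaleˡ s′ (q^ exponent e (suc i) ⊛ inv P′) u ⟩
    s′ · ((q^ exponent e (suc i) ⊛ inv P′) ⊛ u)              ≈⟨ ·-congʳ s′ (⊛-assoc (q^ exponent e (suc i)) (inv P′) u) ⟩
    s′ · (q^ exponent e (suc i) ⊛ (inv P′ ⊛ u))              ≈⟨ ·-congʳ s′ (⊛-congʳ (q^ exponent e (suc i)) (inv-qPoch-suc t i 1≤t)) ⟩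
    s′ · (q^ exponent e (suc i) ⊛ inv P)                     ≡⟨ cong (λ m → s′ · (q^ m ⊛ inv P)) (exponent-suc e i) ⟩
    s′ · (q^ (d ℕ.+ exponent e i) ⊛ inv P)                   ≈⟨ ·-congʳ s′ (⊛-congˡ (inv P) (q^-⊛-q^ d (exponent e i))) ⟨
    s′ · ((q^ d ⊛ q^ exponent e i) ⊛ inv P)                  ≈⟨ ·-congʳ s′ (⊛-assoc (q^ d) (q^ exponent e i) (inv P)) ⟩
    s′ · (q^ d ⊛ (q^ exponent e i ⊛ inv P))                  ≈⟨ sign-suc i (q^ d ⊛ (q^ exponent e i ⊛ inv P)) ⟩
    (- + 1) · (sign i · (q^ d ⊛ (q^ exponent e i ⊛ inv P)))  ≈⟨ ·-congʳ (- + 1) (⊛-scaleʳ (sign i) (q^ d) (q^ exponent e i ⊛ inv P)) ⟨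
    (- + 1) · (q^ d ⊛ B e i)                                 ∎
    where
    open ≗-Reasoning
    s′ = sign (suc i)
    d  = e ℕ.+ t ℕ.* i
    P P′ u : Series
    P  = qPoch t t i
    P′ = qPoch t t (suc i)
    u  = oneMinusQ^ (t ℕ.+ t ℕ.* i)

  B-suc : ∀ e i → B e (suc i) ⊕ (q^ (e ℕ.+ t ℕ.* i) ⊛ B e i) ≗ q^ (t ℕ.+ t ℕ.* i) ⊛ B e (suc i)
  B-suc e i n = begin
    x + z                                                  ≡⟨ cong (_+ z) (⊛-oneMinusQ^ (B e (suc i)) (t ℕ.+ t ℕ.* i) n) ⟨
    (B e (suc i) ⊛ oneMinusQ^ (t ℕ.+ t ℕ.* i)) n + y + z   ≡⟨ cong (λ w → w + y + z) (B-⊛-oneMinusQ^ e i n) ⟩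
    - + 1 * z + y + z                                      ≡⟨ cancel y z ⟩
    y                                                      ∎
    where
    open ≡-Reasoning
    x = B e (suc i) n
    y = (q^ (t ℕ.+ t ℕ.* i) ⊛ B e (suc i)) n
    z = (q^ (e ℕ.+ t ℕ.* i) ⊛ B e i) n
    cancel : ∀ y z → - + 1 * z + y + z ≡ y
    cancel = solve-∀

  B-1+t : ∀ i → B (suc t) i ≗ q^ (t ℕ.* i) ⊛ B 1 i
  B-1+t i = subst (λ e → B e i ≗ q^ (t ℕ.* i) ⊛ B 1 i) (ℕP.+-comm t 1) (B-shift t 1 i)

  B-1-suc : ∀ i → B 1 (suc i) ⊕ (q^ 1 ⊛ B (suc t) i) ≗ B (suc t) (suc i)
  B-1-suc i = begin
    B 1 (suc i) ⊕ (q^ 1 ⊛ B (suc t) i)           ≈⟨ ⊕-congʳ (B 1 (suc i)) shift ⟩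
    B 1 (suc i) ⊕ (q^ (1 ℕ.+ t ℕ.* i) ⊛ B 1 i)   ≈⟨ B-suc 1 i ⟩
    q^ (t ℕ.+ t ℕ.* i) ⊛ B 1 (suc i)             ≡⟨ cong (λ m → q^ m ⊛ B 1 (suc i)) (ℕP.*-suc t i) ⟨
    q^ (t ℕ.* suc i) ⊛ B 1 (suc i)               ≈⟨ B-1+t (suc i) ⟨
    B (suc t) (suc i)                            ∎
    where
    open ≗-Reasoning
    shift : q^ 1 ⊛ B (suc t) i ≗ q^ (1 ℕ.+ t ℕ.* i) ⊛ B 1 i
    shift = begin
      q^ 1 ⊛ B (suc t) i               ≈⟨ ⊛-congʳ (q^ 1) (B-1+t i) ⟩
      q^ 1 ⊛ (q^ (t ℕ.* i) ⊛ B 1 i)    ≈⟨ ⊛-assoc (q^ 1) (q^ (t ℕ.* i)) (B 1 i) ⟨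
      (q^ 1 ⊛ q^ (t ℕ.* i)) ⊛ B 1 i    ≈⟨ ⊛-congˡ (B 1 i) (q^-⊛-q^ 1 (t ℕ.* i)) ⟩
      q^ (1 ℕ.+ t ℕ.* i) ⊛ B 1 i       ∎

  Y-zero : ∀ e → Y e 0 ≗ one
  Y-zero e = begin
    (A ⋆ B e) 0   ≈⟨ ⋆-zero A (B e) ⟩
    A 0 ⊛ B e 0   ≈⟨ ⊛-cong A-zero (B-zero e) ⟩
    one ⊛ one     ≈⟨ ⊛-identityˡ one ⟩
    one           ∎
    where open ≗-Reasoning

  Y-suc-suc : ∀ e j → Y (suc e) (suc j) ≗ (q^ 1 ⊛ Y (suc e) j) ⊕ (q^ suc j ⊛ Y e (suc j))
  Y-suc-suc e j = begin
    (A ⋆ B (suc e)) (suc j)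
      ≈⟨ ⋆-suc-back A (B (suc e)) j ⟩
    ((A ∘ suc) ⋆ B (suc e)) j ⊕ (A 0 ⊛ B (suc e) (suc j))
      ≈⟨ ⊕-cong (⋆-congˡ (B (suc e)) j A-suc) (⊛-congˡ (B (suc e) (suc j)) (λ n → sym (q^-⊛-≤ (A 0) (z≤n {n})))) ⟩
    ((λ m → (q^ 1 ⊛ A m) ⊕ qA (suc m)) ⋆ B (suc e)) j ⊕ (qA 0 ⊛ B (suc e) (suc j))
      ≈⟨ ⊕-congˡ (qA 0 ⊛ B (suc e) (suc j)) (⋆-distribˡ-⊕ (λ m → q^ 1 ⊛ A m) (qA ∘ suc) (B (suc e)) j) ⟩
    (((λ m → q^ 1 ⊛ A m) ⋆ B (suc e)) j ⊕ ((qA ∘ suc) ⋆ B (suc e)) j) ⊕ (qA 0 ⊛ B (suc e) (suc j))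
      ≈⟨ ⊕-assoc (((λ m → q^ 1 ⊛ A m) ⋆ B (suc e)) j) (((qA ∘ suc) ⋆ B (suc e)) j) (qA 0 ⊛ B (suc e) (suc j)) ⟩
    ((λ m → q^ 1 ⊛ A m) ⋆ B (suc e)) j ⊕ (((qA ∘ suc) ⋆ B (suc e)) j ⊕ (qA 0 ⊛ B (suc e) (suc j)))
      ≈⟨ ⊕-congˡ (((qA ∘ suc) ⋆ B (suc e)) j ⊕ (qA 0 ⊛ B (suc e) (suc j))) (⋆-⊛ˡ (q^ 1) A (B (suc e)) j) ⟩
    (q^ 1 ⊛ Y (suc e) j) ⊕ (((qA ∘ suc) ⋆ B (suc e)) j ⊕ (qA 0 ⊛ B (suc e) (suc j)))
      ≈⟨ ⊕-congʳ (q^ 1 ⊛ Y (suc e) j) (⋆-suc-back qA (B (suc e)) j) ⟨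
    (q^ 1 ⊛ Y (suc e) j) ⊕ (qA ⋆ B (suc e)) (suc j)
      ≈⟨ ⊕-congʳ (q^ 1 ⊛ Y (suc e) j) (⋆-congʳ qA (suc j) B-1+e) ⟩
    (q^ 1 ⊛ Y (suc e) j) ⊕ (qA ⋆ (λ i → q^ i ⊛ B e i)) (suc j)
      ≈⟨ ⊕-congʳ (q^ 1 ⊛ Y (suc e) j) (⋆-q^ A (B e) (suc j)) ⟩
    (q^ 1 ⊛ Y (suc e) j) ⊕ (q^ suc j ⊛ Y e (suc j))
      ∎
    where
    open ≗-Reasoning
    qA : ℕ → Series
    qA m = q^ m ⊛ A m
    B-1+e : ∀ i → B (suc e) i ≗ q^ i ⊛ B e i
    B-1+e i = subst (λ k → B (suc e) i ≗ q^ k ⊛ B e i) (ℕP.*-identityˡ i) (B-shift 1 e i)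

  Y-1-suc-⊕ : ∀ j → Y 1 (suc j) ⊕ (q^ 1 ⊛ Y (suc t) j) ≗ Y (suc t) (suc j)
  Y-1-suc-⊕ j = begin
    ((A (suc j) ⊛ B 1 0) ⊕ (A ⋆ (B 1 ∘ suc)) j) ⊕ (q^ 1 ⊛ Y (suc t) j)
      ≈⟨ ⊕-assoc (A (suc j) ⊛ B 1 0) ((A ⋆ (B 1 ∘ suc)) j) (q^ 1 ⊛ Y (suc t) j) ⟩
    (A (suc j) ⊛ B 1 0) ⊕ ((A ⋆ (B 1 ∘ suc)) j ⊕ (q^ 1 ⊛ Y (suc t) j))
      ≈⟨ ⊕-congʳ (A (suc j) ⊛ B 1 0) (⊕-congʳ ((A ⋆ (B 1 ∘ suc)) j) (⋆-⊛ʳ (q^ 1) A (B (suc t)) j)) ⟨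
    (A (suc j) ⊛ B 1 0) ⊕ ((A ⋆ (B 1 ∘ suc)) j ⊕ (A ⋆ (λ i → q^ 1 ⊛ B (suc t) i)) j)
      ≈⟨ ⊕-congʳ (A (suc j) ⊛ B 1 0) (⋆-distribʳ-⊕ A (B 1 ∘ suc) (λ i → q^ 1 ⊛ B (suc t) i) j) ⟨
    (A (suc j) ⊛ B 1 0) ⊕ (A ⋆ (λ i → B 1 (suc i) ⊕ (q^ 1 ⊛ B (suc t) i))) j
      ≈⟨ ⊕-cong (⊛-congʳ (A (suc j)) (λ n → trans (B-zero 1 n) (sym (B-zero (suc t) n)))) (⋆-congʳ A j B-1-suc) ⟩
    (A (suc j) ⊛ B (suc t) 0) ⊕ (A ⋆ (B (suc t) ∘ suc)) j
      ∎
    where open ≗-Reasoning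

  Y-1-suc : ∀ j → Y 1 (suc j) ≗ q^ suc j ⊛ Y t (suc j)
  Y-1-suc j n = ∙-cancelʳ ((q^ 1 ⊛ Y (suc t) j) n) (Y 1 (suc j) n) ((q^ suc j ⊛ Y t (suc j)) n)
    (trans (Y-1-suc-⊕ j n) (trans (Y-suc-suc t j n) (ℤP.+-comm ((q^ 1 ⊛ Y (suc t) j) n) _)))

  rhs≗Y : ∀ j → rhs t j ≗ Y t j
  rhs≗Y j n = trans (sumℤ-map-applyUpTo (λ i → term i n) id (suc j)) (∑-cong (suc j) (λ i _ → term≗ i n))
    where
    term : ℕ → Series
    term i = ((q^ (j ∸ i) ⊛ inv (qPoch 1 1 (j ∸ i))) ⊛ mono (sign i) ((suc i C 2) ℕ.* t)) ⊛ inv (qPoch t t i)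
    term≗ : ∀ i → term i ≗ A (j ∸ i) ⊛ B t i
    term≗ i = begin
      (A (j ∸ i) ⊛ mono (sign i) ((suc i C 2) ℕ.* t)) ⊛ inv P   ≈⟨ ⊛-assoc (A (j ∸ i)) (mono (sign i) ((suc i C 2) ℕ.* t)) (inv P) ⟩
      A (j ∸ i) ⊛ (mono (sign i) ((suc i C 2) ℕ.* t) ⊛ inv P)   ≈⟨ ⊛-congʳ (A (j ∸ i)) (⊛-congˡ (inv P) (mono≗· (sign i) ((suc i C 2) ℕ.* t))) ⟩
      A (j ∸ i) ⊛ ((sign i · q^ ((suc i C 2) ℕ.* t)) ⊛ inv P)   ≈⟨ ⊛-congʳ (A (j ∸ i)) (⊛-scaleˡ (sign i) (q^ ((suc i C 2) ℕ.* t)) (inv P)) ⟩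
      A (j ∸ i) ⊛ (sign i · (q^ ((suc i C 2) ℕ.* t) ⊛ inv P))   ≡⟨ cong (λ m → A (j ∸ i) ⊛ (sign i · (q^ m ⊛ inv P))) exponent-t ⟩
      A (j ∸ i) ⊛ B t i                                        ∎
      where
      open ≗-Reasoning
      P = qPoch t t i
      regroup : ∀ i c t → (i ℕ.+ c) ℕ.* t ≡ t ℕ.* i ℕ.+ c ℕ.* t
      regroup = NS.solve-∀
      exponent-t : (suc i C 2) ℕ.* t ≡ exponent t i
      exponent-t = trans (cong (ℕ._* t) (suc-C-2 i)) (regroup i (i C 2) t)

-- Enumerating partitions

Linked-reverse : ∀ {A : Set} {R : A → A → Set} xs → Linked R xs → Linked (flip R) (reverse xs)
Linked-reverse         []       _   = []
Linked-reverse {R = R} (x ∷ xs) Rxs = go x xs [] Rxs [-]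
  where
  go : ∀ x xs acc → Linked R (x ∷ xs) → Linked (flip R) (x ∷ acc) → Linked (flip R) (foldl (flip _∷_) (x ∷ acc) xs)
  go x []       acc _           Racc = Racc
  go x (y ∷ ys) acc (Rxy ∷ Rys) Racc = go y ys (x ∷ acc) Rys (Rxy ∷ Racc)

All-reverse : ∀ {A : Set} {P : A → Set} xs → All P xs → All P (reverse xs)
All-reverse xs = All-resp-↭ (↭-sym (↭-reverse xs))

sum-reverse : ∀ xs → sumℕ (reverse xs) ≡ sumℕ xs
sum-reverse xs = sum-↭ (↭-reverse xs)

sum-map-suc : ∀ ys → sumℕ (map suc ys) ≡ sumℕ ys ℕ.+ length ys
sum-map-suc []       = refl
sum-map-suc (y ∷ ys) = trans (cong (λ x → suc (y ℕ.+ x)) (sum-map-suc ys)) (regroup y (sumℕ ys) (length ys))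
  where
  regroup : ∀ y s l → suc (y ℕ.+ (s ℕ.+ l)) ≡ y ℕ.+ s ℕ.+ suc l
  regroup = NS.solve-∀

length≤sum : ∀ {zs} → All (1 ≤_) zs → length zs ≤ sumℕ zs
length≤sum []          = z≤n
length≤sum (1≤z ∷ pos) = ℕP.+-mono-≤ 1≤z (length≤sum pos)

All-≤-map-suc : ∀ {m} zs → All (suc m ≤_) zs → ∃[ ys ] zs ≡ map suc ys × All (m ≤_) ys
All-≤-map-suc []           []             = [] , refl , []
All-≤-map-suc (suc z ∷ zs) (s≤s m≤z ∷ ps) with All-≤-map-suc zs ps
... | ys , refl , qs = z ∷ ys , refl , m≤z ∷ qs

∸-suc-< : ∀ {n f} j → 1 ≤ n → n < suc f → n ∸ suc j < f
∸-suc-< {suc n} j _ (s≤s n<f) = ℕP.≤-<-trans (ℕP.m∸n≤m n j) n<f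

module Ascending (t : ℕ) where

  Admissible : ℕ → ℕ → Set
  Admissible s p = ¬ t ∣ p ℕ.+ s

  record AscPartition (s j n : ℕ) (xs : List ℕ) : Set where
    constructor ascPartition
    field
      ascending  : Linked _≤_ xs
      positive   : All (1 ≤_) xs
      admissible : All (Admissible s) xs
      total      : sumℕ xs ≡ n
      size       : length xs ≡ j

  AscPartition-map-suc : ∀ {s j m ys} → AscPartition (suc s) j m ys → AscPartition s j (m ℕ.+ j) (map suc ys)
  AscPartition-map-suc {s} {ys = ys} (ascPartition asc pos adm refl refl) = ascPartition
    (LinkedP.map⁺ (Linked.map s≤s asc))
    (AllP.map⁺ (All.map (λ _ → s≤s z≤n) pos))
    (AllP.map⁺ (All.map (λ {y} adm-y t∣ → adm-y (subst (t ∣_) (sym (ℕP.+-suc y s)) t∣)) adm))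
    (sum-map-suc ys)
    (LP.length-map suc ys)

  AscPartition-map-pred : ∀ {s j n ys} → AscPartition s j n (map suc ys) → All (1 ≤_) ys →
                          AscPartition (suc s) j (n ∸ j) ys
  AscPartition-map-pred {s} {ys = ys} (ascPartition asc _ adm refl refl) pos = ascPartition
    (Linked.map ℕ.s≤s⁻¹ (LinkedP.map⁻ asc))
    pos
    (All.map (λ {y} adm-y t∣ → adm-y (subst (t ∣_) (ℕP.+-suc y s) t∣)) (AllP.map⁻ adm))
    (sym (trans (cong₂ _∸_ (sum-map-suc ys) (LP.length-map suc ys)) (ℕP.m+n∸n≡m (sumℕ ys) (length ys))))
    (sym (LP.length-map suc ys))

  AscPartition⇒TRegPartition : ∀ {j n xs} → AscPartition 0 j n xs → TRegPartition t j n (reverse xs)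
  AscPartition⇒TRegPartition {xs = xs} (ascPartition asc pos adm total size) =
    record { decreasing = Linked-reverse xs asc ; positive = All-reverse xs pos ; total = trans (sum-reverse xs) total }
    , All-reverse xs (All.map (λ {p} adm-p t∣p → adm-p (subst (t ∣_) (sym (ℕP.+-identityʳ p)) t∣p)) adm)
    , trans (LP.length-reverse xs) size

  TRegPartition⇒AscPartition : ∀ {j n λs} → TRegPartition t j n λs → AscPartition 0 j n (reverse λs)
  TRegPartition⇒AscPartition {λs = λs} (P , regular , size) = ascPartition
    (Linked-reverse λs decreasing)
    (All-reverse λs positive)
    (All-reverse λs (All.map (λ {p} t∤p t∣p → t∤p (subst (t ∣_) (ℕP.+-identityʳ p) t∣p)) regular))
    (trans (sum-reverse λs) total)
    (trans (LP.length-reverse λs) size)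
    where open IsPartitionOf P

  -- A part p listed with shift s stands for the part p + s: s counts how often 1 has been removed
  -- from every part. The fuel f only has to exceed n.
  ascPartitions : (f s j n : ℕ) → List (List ℕ)
  startingWithOne : (f s j n : ℕ) → List (List ℕ)
  aboveOne : (f s j n : ℕ) → List (List ℕ)

  ascPartitions f       s zero    zero    = [] ∷ []
  ascPartitions f       s zero    (suc n) = []
  ascPartitions zero    s (suc j) n       = []
  ascPartitions (suc f) s (suc j) n       = startingWithOne f s j n ++ aboveOne f s j n

  startingWithOne f s j zero = []
  startingWithOne f s j (suc n) with t ∣? suc s
  ... | yes _ = []
  ... | no _  = map (1 ∷_) (ascPartitions f s j n)

  aboveOne f s j n with suc j ≤? n
  ... | yes _ = map (map suc) (ascPartitions f (suc s) (suc j) (n ∸ suc j))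
  ... | no _  = []

  startingWithOne-admissible : ∀ f s j n → ¬ t ∣ suc s →
                               startingWithOne f s j (suc n) ≡ map (1 ∷_) (ascPartitions f s j n)
  startingWithOne-admissible f s j n t∤1+s with t ∣? suc s
  ... | yes t∣1+s = ⊥-elim (t∤1+s t∣1+s)
  ... | no _      = refl

  startingWithOne-empty : ∀ f s j n → t ∣ suc s → startingWithOne f s j n ≡ []
  startingWithOne-empty f s j zero    _     = refl
  startingWithOne-empty f s j (suc n) t∣1+s with t ∣? suc s
  ... | yes _    = refl
  ... | no t∤1+s = ⊥-elim (t∤1+s t∣1+s)

  aboveOne-fits : ∀ f s j n → suc j ≤ n → aboveOne f s j n ≡ map (map suc) (ascPartitions f (suc s) (suc j) (n ∸ suc j))
  aboveOne-fits f s j n 1+j≤n with suc j ≤? n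
  ... | yes _    = refl
  ... | no 1+j≰n = ⊥-elim (1+j≰n 1+j≤n)

  aboveOne-¬fits : ∀ f s j n → ¬ suc j ≤ n → aboveOne f s j n ≡ []
  aboveOne-¬fits f s j n 1+j≰n with suc j ≤? n
  ... | yes 1+j≤n = ⊥-elim (1+j≰n 1+j≤n)
  ... | no _      = refl

  ascPartitions-sound : ∀ f s j n {xs} → xs ∈ ascPartitions f s j n → AscPartition s j n xs
  startingWithOne-sound : ∀ f s j n {xs} → xs ∈ startingWithOne f s j n → AscPartition s (suc j) n xs
  aboveOne-sound : ∀ f s j n {xs} → xs ∈ aboveOne f s j n → AscPartition s (suc j) n xs

  ascPartitions-sound f       s zero    zero (here refl) = ascPartition [] [] [] refl refl
  ascPartitions-sound (suc f) s (suc j) n    xs∈ with ∈-++⁻ (startingWithOne f s j n) xs∈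
  ... | inj₁ xs∈₁ = startingWithOne-sound f s j n xs∈₁
  ... | inj₂ xs∈₂ = aboveOne-sound f s j n xs∈₂

  startingWithOne-sound f s j (suc n) xs∈ with t ∣? suc s
  ... | no t∤1+s with ∈-map⁻ (1 ∷_) xs∈
  ...   | ys , ys∈ , refl with ascPartitions-sound f s j n ys∈
  ...     | ascPartition asc pos adm total size =
    ascPartition (1∷-ascending pos asc) (s≤s z≤n ∷ pos) (t∤1+s ∷ adm) (cong suc total) (cong suc size)
    where
    1∷-ascending : ∀ {zs} → All (1 ≤_) zs → Linked _≤_ zs → Linked _≤_ (1 ∷ zs)
    1∷-ascending []        _   = [-]
    1∷-ascending (1≤z ∷ _) asc = 1≤z ∷ asc

  aboveOne-sound f s j n xs∈ with suc j ≤? n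
  ... | yes 1+j≤n with ∈-map⁻ (map suc) xs∈
  ...   | ys , ys∈ , refl = subst (λ m → AscPartition s (suc j) m (map suc ys)) (ℕP.m∸n+n≡m 1+j≤n)
          (AscPartition-map-suc (ascPartitions-sound f (suc s) (suc j) (n ∸ suc j) ys∈))

  ascPartitions-complete : ∀ f s j n {xs} → n < f → AscPartition s j n xs → xs ∈ ascPartitions f s j n
  startingWithOne-complete : ∀ f s j {m xs} → Admissible s 1 → m < f → AscPartition s j m xs →
                             1 ∷ xs ∈ startingWithOne f s j (suc m)
  aboveOne-complete : ∀ f s j n {ys} → n < suc f → AscPartition s (suc j) n (map suc ys) → All (1 ≤_) ys →
                      map suc ys ∈ aboveOne f s j n

  ascPartitions-complete f s j n {[]} _ (ascPartition _ _ _ refl refl) = here refl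
  ascPartitions-complete (suc f) s (suc j) n {zero ∷ xs} _ (ascPartition _ (() ∷ _) _ _ _)
  ascPartitions-complete (suc f) s (suc j) .(suc (sumℕ xs)) {1 ∷ xs} (s≤s n<f)
    (ascPartition asc (_ ∷ pos) (adm-1 ∷ adm) refl refl) =
    ∈-++⁺ˡ (startingWithOne-complete f s j adm-1 n<f (ascPartition (Linked.tail asc) pos adm refl refl))
  ascPartitions-complete (suc f) s (suc j) n {suc (suc x) ∷ xs} n<f P@(ascPartition asc _ _ _ _)
    with All-≤-map-suc (suc (suc x) ∷ xs) (LinkedP.Linked⇒All ℕP.≤-trans (s≤s (s≤s z≤n)) asc)
  ... | ys , eq , pos = ∈-++⁺ʳ (startingWithOne f s j n)
    (subst (_∈ aboveOne f s j n) (sym eq) (aboveOne-complete f s j n n<f (subst (AscPartition s (suc j) n) eq P) pos))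

  startingWithOne-complete f s j {m} adm-1 m<f P with t ∣? suc s
  ... | yes t∣1+s = ⊥-elim (adm-1 t∣1+s)
  ... | no _      = ∈-map⁺ (1 ∷_) (ascPartitions-complete f s j m m<f P)

  aboveOne-complete f s j n {ys} n<f P pos with suc j ≤? n
  ... | yes 1+j≤n = ∈-map⁺ (map suc) (ascPartitions-complete f (suc s) (suc j) (n ∸ suc j)
          (∸-suc-< j (ℕP.≤-trans (s≤s z≤n) 1+j≤n) n<f) (AscPartition-map-pred P pos))
  ... | no 1+j≰n  = ⊥-elim (1+j≰n (subst₂ _≤_ size total (length≤sum positive)))
    where open AscPartition P

  startingWithOne-head : ∀ f s j n {xs} → xs ∈ startingWithOne f s j n → ∃[ ys ] xs ≡ 1 ∷ ys
  startingWithOne-head f s j (suc n) xs∈ with t ∣? suc s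
  ... | no _ with ∈-map⁻ (1 ∷_) xs∈
  ...   | ys , _ , refl = ys , refl

  aboveOne-≥2 : ∀ f s j n {xs} → xs ∈ aboveOne f s j n → All (2 ≤_) xs
  aboveOne-≥2 f s j n xs∈ with suc j ≤? n
  ... | yes _ with ∈-map⁻ (map suc) xs∈
  ...   | ys , ys∈ , refl =
    AllP.map⁺ (All.map s≤s (AscPartition.positive (ascPartitions-sound f (suc s) (suc j) (n ∸ suc j) ys∈)))

  ascPartitions-unique : ∀ f s j n → Unique (ascPartitions f s j n)
  startingWithOne-unique : ∀ f s j n → Unique (startingWithOne f s j n)
  aboveOne-unique : ∀ f s j n → Unique (aboveOne f s j n)

  ascPartitions-unique f       s zero    zero    = [] ∷ []
  ascPartitions-unique f       s zero    (suc n) = []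
  ascPartitions-unique zero    s (suc j) n       = []
  ascPartitions-unique (suc f) s (suc j) n       =
    UniqueP.++⁺ (startingWithOne-unique f s j n) (aboveOne-unique f s j n) disjoint
    where
    disjoint : Disjoint (startingWithOne f s j n) (aboveOne f s j n)
    disjoint (xs∈₁ , xs∈₂) with startingWithOne-head f s j n xs∈₁ | aboveOne-≥2 f s j n xs∈₂
    ... | _ , refl | s≤s () ∷ _

  startingWithOne-unique f s j zero = []
  startingWithOne-unique f s j (suc n) with t ∣? suc s
  ... | yes _ = []
  ... | no _  = UniqueP.map⁺ LP.∷-injectiveʳ (ascPartitions-unique f s j n)

  aboveOne-unique f s j n with suc j ≤? n
  ... | yes _ = UniqueP.map⁺ (LP.map-injective ℕP.suc-injective) (ascPartitions-unique f (suc s) (suc j) (n ∸ suc j))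
  ... | no _  = []

-- Counting

module Counting {t : ℕ} (1≤t : 1 ≤ t) where

  open FormalSums 1≤t
  open Ascending t

  Counts : (f s e j : ℕ) → Set
  Counts f s e j = ∀ {n} → n < f → + length (ascPartitions f s j n) ≡ Y e j n

  startingWithOne-count : ∀ f s e j {n} → ¬ t ∣ suc s → Counts f s e j → n < suc f →
                          + length (startingWithOne f s j n) ≡ (q^ 1 ⊛ Y e j) n
  startingWithOne-count f s e j {zero}  _     _     _         = sym (q^-⊛-< {1} (Y e j) (s≤s z≤n))
  startingWithOne-count f s e j {suc n} t∤1+s count (s≤s n<f) = begin
    + length (startingWithOne f s j (suc n))       ≡⟨ cong (+_ ∘ length) (startingWithOne-admissible f s j n t∤1+s) ⟩
    + length (map (1 ∷_) (ascPartitions f s j n))  ≡⟨ cong +_ (LP.length-map (1 ∷_) (ascPartitions f s j n)) ⟩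
    + length (ascPartitions f s j n)               ≡⟨ count n<f ⟩
    Y e j n                                        ≡⟨ q^-⊛-≤ {1} {suc n} (Y e j) (s≤s z≤n) ⟨
    (q^ 1 ⊛ Y e j) (suc n)                         ∎
    where open ≡-Reasoning

  aboveOne-count : ∀ f s e j {n} → Counts f (suc s) e (suc j) → n < suc f →
                   + length (aboveOne f s j n) ≡ (q^ suc j ⊛ Y e (suc j)) n
  aboveOne-count f s e j {n} count n<f = [ fits , ¬fits ]′ (ℕP.≤-<-connex (suc j) n)
    where
    open ≡-Reasoning
    G = ascPartitions f (suc s) (suc j) (n ∸ suc j)
    fits : suc j ≤ n → + length (aboveOne f s j n) ≡ (q^ suc j ⊛ Y e (suc j)) n
    fits 1+j≤n = begin
      + length (aboveOne f s j n)  ≡⟨ cong (+_ ∘ length) (aboveOne-fits f s j n 1+j≤n) ⟩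
      + length (map (map suc) G)   ≡⟨ cong +_ (LP.length-map (map suc) G) ⟩
      + length G                   ≡⟨ count (∸-suc-< j (ℕP.≤-trans (s≤s z≤n) 1+j≤n) n<f) ⟩
      Y e (suc j) (n ∸ suc j)      ≡⟨ q^-⊛-≤ (Y e (suc j)) 1+j≤n ⟨
      (q^ suc j ⊛ Y e (suc j)) n   ∎
    ¬fits : n < suc j → + length (aboveOne f s j n) ≡ (q^ suc j ⊛ Y e (suc j)) n
    ¬fits n<1+j = begin
      + length (aboveOne f s j n)  ≡⟨ cong (+_ ∘ length) (aboveOne-¬fits f s j n (ℕP.<⇒≱ n<1+j)) ⟩
      + 0                          ≡⟨ q^-⊛-< (Y e (suc j)) n<1+j ⟨
      (q^ suc j ⊛ Y e (suc j)) n   ∎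

  -- The parts of the listed partitions avoid the residue class of -s, which is that of e.
  count : ∀ f s e j → 1 ≤ e → e ≤ t → t ∣ e ℕ.+ s → Counts f s e j
  count f       s e             zero    _ _ _ {zero}  _ = sym (Y-zero e 0)
  count f       s e             zero    _ _ _ {suc n} _ = sym (Y-zero e (suc n))
  count zero    s e             (suc j) _ _ _ ()
  count (suc f) s 1             (suc j) _ _ t∣1+s {n} n<f = begin
    + length (startingWithOne f s j n ++ aboveOne f s j n)
      ≡⟨ cong (λ xs → + length (xs ++ aboveOne f s j n)) (startingWithOne-empty f s j n t∣1+s) ⟩
    + length (aboveOne f s j n)
      ≡⟨ aboveOne-count f s t j (count f (suc s) t (suc j) 1≤t ℕP.≤-refl (∣m∣n⇒∣m+n ∣-refl t∣1+s)) n<f ⟩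
    (q^ suc j ⊛ Y t (suc j)) n
      ≡⟨ Y-1-suc j n ⟨
    Y 1 (suc j) n
      ∎
    where open ≡-Reasoning
  count (suc f) s (suc (suc e)) (suc j) _ 2+e≤t t∣2+e+s {n} n<f = begin
    + length (startingWithOne f s j n ++ aboveOne f s j n)
      ≡⟨ cong +_ (LP.length-++ (startingWithOne f s j n)) ⟩
    + (length (startingWithOne f s j n) ℕ.+ length (aboveOne f s j n))
      ≡⟨ ℤP.pos-+ (length (startingWithOne f s j n)) _ ⟩
    + length (startingWithOne f s j n) + + length (aboveOne f s j n)
      ≡⟨ cong₂ _+_ (startingWithOne-count f s (suc (suc e)) j t∤1+s (count f s (suc (suc e)) j (s≤s z≤n) 2+e≤t t∣2+e+s) n<f)
                   (aboveOne-count f s (suc e) j (count f (suc s) (suc e) (suc j) (s≤s z≤n) (ℕP.<⇒≤ 2+e≤t) t∣1+e+1+s) n<f) ⟩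
    (q^ 1 ⊛ Y (suc (suc e)) j) n + (q^ suc j ⊛ Y (suc e) (suc j)) n
      ≡⟨ Y-suc-suc (suc e) j n ⟨
    Y (suc (suc e)) (suc j) n
      ∎
    where
    open ≡-Reasoning
    t∣1+e+1+s : t ∣ suc e ℕ.+ suc s
    t∣1+e+1+s = subst (t ∣_) (sym (ℕP.+-suc (suc e) s)) t∣2+e+s
    t∤1+s : ¬ t ∣ suc s
    t∤1+s t∣1+s = ℕP.<⇒≱ 2+e≤t (∣⇒≤ (∣m+n∣m⇒∣n (subst (t ∣_) (ℕP.+-comm (suc e) (suc s)) t∣1+e+1+s) t∣1+s))

lemma10 : (t j : ℕ) → t ≥ 2 → (n : ℕ) →
    Σ (List (List ℕ)) (λ L →
      Unique L ×
      ((λs : List ℕ) → (λs ∈ L) ⇔ TRegPartition t j n λs) ×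
      (+ length L ≡ rhs t j n))
lemma10 t j t≥2 n = map reverse G , unique , (λ λs → mk⇔ to (from λs)) , counted
  where
  1≤t : 1 ≤ t
  1≤t = ℕP.≤-trans (s≤s z≤n) t≥2
  open Ascending t
  open FormalSums 1≤t
  open Counting 1≤t
  G = ascPartitions (suc n) 0 j n
  unique : Unique (map reverse G)
  unique = UniqueP.map⁺ LP.reverse-injective (ascPartitions-unique (suc n) 0 j n)
  to : ∀ {λs} → λs ∈ map reverse G → TRegPartition t j n λs
  to λs∈ with ∈-map⁻ reverse λs∈
  ... | xs , xs∈ , refl = AscPartition⇒TRegPartition (ascPartitions-sound (suc n) 0 j n xs∈)
  from : ∀ λs → TRegPartition t j n λs → λs ∈ map reverse G
  from λs P = subst (_∈ map reverse G) (LP.reverse-involutive λs)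
    (∈-map⁺ reverse (ascPartitions-complete (suc n) 0 j n ℕP.≤-refl (TRegPartition⇒AscPartition P)))
  counted : + length (map reverse G) ≡ rhs t j n
  counted = begin
    + length (map reverse G)  ≡⟨ cong +_ (LP.length-map reverse G) ⟩
    + length G                ≡⟨ count (suc n) 0 t j 1≤t ℕP.≤-refl (subst (t ∣_) (sym (ℕP.+-identityʳ t)) ∣-refl) ℕP.≤-refl ⟩
    Y t j n                   ≡⟨ rhs≗Y j n ⟨
    rhs t j n                 ∎
    where open ≡-Reasoning
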